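{- Let $k$ and $n$ be non-negative integers. Let $p_1,p_2,\ldots,p_{k+1}$ be odd primes such that $p_i\not\equiv 1 \pmod 4$ for each $1\leq i\leq k+1$. Then for any integer $j\not\equiv 0 \pmod{p_{k+1}}$, $$\bar{B}_{5,2}\left(4p_1^2p_2^2\cdots p_k^2p_{k+1}^2 n + (4j+p_{k+1})p_1^2p_2^2\cdots p_k^2 p_{k+1}\right)\equiv 0 \pmod 4.$$
   Context: An overpartition of a positive integer $n$ is a partition of $n$ in which the first occurrence of each distinct part may be overlined. For coprime integers $\ell_1,\ell_2>1$, $\bar{B}_{\ell_1,\ell_2}(n)$ denotes the number of overpartitions of $n$ in which no part is divisible by $\ell_1$ or by $\ell_2$, with $\bar{B}_{\ell_1,\ell_2}(0)=1$. -}

module Defs where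

open import Data.Nat using (ℕ; zero; suc; _+_; _*_; _∸_; _≤ᵇ_; _≡ᵇ_)
open import Data.Nat.Divisibility using (_∣_)
open import Data.Bool using (Bool; true; false; if_then_else_; not; _∧_)
open import Data.Vec using (Vec; []; _∷_)

open import Data.Nat.DivMod using (_%_)

allowed : (ℓ₁ ℓ₂ : ℕ) .{{_ : Data.Nat.NonZero ℓ₁}} .{{_ : Data.Nat.NonZero ℓ₂}} → ℕ → Bool
allowed ℓ₁ ℓ₂ m = not (m % ℓ₁ ≡ᵇ 0) ∧ not (m % ℓ₂ ≡ᵇ 0)

sumFrom1 : ℕ → (ℕ → ℕ) → ℕ
sumFrom1 zero    f = 0
sumFrom1 (suc k) f = sumFrom1 k f + f (suc k)

-- overCount ok m n : number of overpartitions of n all of whose parts lie in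
-- {1,…,m} and satisfy the predicate ok.  An overpartition is built by choosing,
-- for each allowed part size s ≤ m, a multiplicity c ≥ 0, and, when c ≥ 1,
-- whether the first occurrence of s is overlined (factor 2).
overCount : (ℕ → Bool) → ℕ → ℕ → ℕ
overCount ok zero    n = if n ≡ᵇ 0 then 1 else 0
overCount ok (suc m) n =
  overCount ok m n +
  (if ok (suc m)
     then 2 * sumFrom1 n (λ c → if c * suc m ≤ᵇ n then overCount ok m (n ∸ c * suc m) else 0)
     else 0)

-- B̄_{ℓ₁,ℓ₂}(n): overpartitions of n with no part divisible by ℓ₁ or by ℓ₂.
-- (Parts are ≤ n, so restricting to parts in {1,…,n} loses nothing; B̄(0) = 1.)
Bbar : (ℓ₁ ℓ₂ : ℕ) .{{_ : Data.Nat.NonZero ℓ₁}} .{{_ : Data.Nat.NonZero ℓ₂}} → ℕ → ℕ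
Bbar ℓ₁ ℓ₂ n = overCount (allowed ℓ₁ ℓ₂) n n

prodSq : ∀ {k} → Vec ℕ k → ℕ
prodSq []       = 1
prodSq (p ∷ ps) = p * p * prodSq ps

-- Overlining doubles the contribution of every part size, and the number of overpartitions of m
-- (with parts from any fixed set) is odd exactly when m = 0. Hence, modulo 4, each allowed part
-- size s contributes 2·[s ∣ N], and B̄_{5,2}(N) ≡ 2·d(N) where d(N) counts the divisors of N prime
-- to 10. For the N of the theorem, N = p₁²⋯p_k² q R with R ≡ q (mod 4), so R is odd and prime to
-- q: N is odd and q divides N to an odd power. Removing the factors 5 from N changes neither d(N)
-- nor that odd power, and an N prime to 10 that is not a square has an even number of divisors,
-- paired as d ↔ N/d.
module Submission where

open import Defs
open import Data.Nat using (ℕ)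
open import Data.Nat.Primality using (Prime)
open import Data.Nat.DivMod using (_%_)
open import Data.Nat.Divisibility using (_∣_)
open import Data.Vec using (Vec)
open import Data.Vec.Relation.Unary.All using (All)
open import Data.Integer using (ℤ; +_)
open import Data.Integer.Divisibility using () renaming (_∣_ to _∣ℤ_)
open import Data.Product using (_×_)
open import Relation.Nullary using (¬_)
open import Relation.Binary.PropositionalEquality using (_≡_; _≢_)

open import Data.Bool using (Bool; true; false; if_then_else_; not; _∧_; T)
open import Data.Bool.Properties using (T-∧; T-≡; ∧-identityʳ; ∧-zeroʳ)
open import Data.Empty using (⊥-elim)
import Data.Integer as ℤ
import Data.Integer.Divisibility.Signed as ℤ∣
import Data.Integer.Properties as ℤ
open import Data.Nat
open import Data.Nat.Coprimality using (Coprime; coprime-divisor)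
open import Data.Nat.DivMod
open import Data.Nat.Divisibility
open import Data.Nat.Induction using (<-wellFounded)
open import Data.Nat.Primality
open import Data.Nat.Properties
open import Algebra.Properties.CommutativeSemigroup +-commutativeSemigroup using (interchange)
open import Algebra.Properties.CommutativeSemigroup *-commutativeSemigroup
  using () renaming (x∙yz≈y∙xz to m*[n*o]≡n*[m*o])
open import Data.Nat.Tactic.RingSolver using (solve-∀)
open import Data.Product using (_,_; proj₁)
open import Data.Sum using (inj₁; inj₂; reduce)
open import Data.Vec using ([]; _∷_)
import Data.Vec.Relation.Unary.All as All
open import Function using (_∘_; flip)
open import Function.Bundles using (Equivalence; mk⇔)
open import Induction.WellFounded using (Acc; acc)
open import Relation.Binary using (tri<; tri≈; tri>)
open import Relation.Binary.PropositionalEquality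
  using (refl; sym; trans; cong; cong₂; subst; module ≡-Reasoning)
open import Relation.Nullary using (Dec; yes; no; does)
open import Relation.Nullary.Decidable using (dec-true; dec-false; does-⇔; from-yes)

sumFrom1-cong : ∀ K {f g : ℕ → ℕ} → (∀ c → 1 ≤ c → c ≤ K → f c ≡ g c) →
                sumFrom1 K f ≡ sumFrom1 K g
sumFrom1-cong zero    f≡g = refl
sumFrom1-cong (suc K) f≡g =
  cong₂ _+_ (sumFrom1-cong K (λ c 1≤c c≤K → f≡g c 1≤c (m≤n⇒m≤1+n c≤K))) (f≡g (suc K) (s≤s z≤n) ≤-refl)

sumFrom1-zero : ∀ K → sumFrom1 K (λ _ → 0) ≡ 0
sumFrom1-zero zero    = refl
sumFrom1-zero (suc K) = cong (_+ 0) (sumFrom1-zero K)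

sumFrom1-+ : ∀ K (f g : ℕ → ℕ) → sumFrom1 K (λ c → f c + g c) ≡ sumFrom1 K f + sumFrom1 K g
sumFrom1-+ zero    f g = refl
sumFrom1-+ (suc K) f g = begin
  sumFrom1 K (λ c → f c + g c) + (f′ + g′)  ≡⟨ cong (_+ (f′ + g′)) (sumFrom1-+ K f g) ⟩
  sumFrom1 K f + sumFrom1 K g + (f′ + g′)    ≡⟨ interchange (sumFrom1 K f) (sumFrom1 K g) f′ g′ ⟩
  sumFrom1 K f + f′ + (sumFrom1 K g + g′)    ∎
  where
  open ≡-Reasoning
  f′ = f (suc K)
  g′ = g (suc K)

sumFrom1-swap : ∀ K L (h : ℕ → ℕ → ℕ) →
                sumFrom1 K (λ d → sumFrom1 L (h d)) ≡ sumFrom1 L (λ e → sumFrom1 K (λ d → h d e))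
sumFrom1-swap zero    L h = sym (sumFrom1-zero L)
sumFrom1-swap (suc K) L h = trans (cong (_+ sumFrom1 L (h (suc K))) (sumFrom1-swap K L h))
                                  (sym (sumFrom1-+ L (λ e → sumFrom1 K (λ d → h d e)) (h (suc K))))

sumFrom1-truncate : ∀ {m} K (f : ℕ → ℕ) → m ≤ K → (∀ c → m < c → f c ≡ 0) →
                    sumFrom1 K f ≡ sumFrom1 m f
sumFrom1-truncate zero    f z≤n  vanish = refl
sumFrom1-truncate (suc K) f m≤1+K vanish with m≤n⇒m<n∨m≡n m≤1+K
... | inj₂ refl      = refl
... | inj₁ (s≤s m≤K) = trans (cong₂ _+_ (sumFrom1-truncate K f m≤K vanish) (vanish (suc K) (s≤s m≤K)))
                             (+-identityʳ _)

%-cong-+ : ∀ m .{{_ : NonZero m}} a b c d → a % m ≡ c % m → b % m ≡ d % m →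
           (a + b) % m ≡ (c + d) % m
%-cong-+ m a b c d a≡c b≡d = begin
  (a + b) % m            ≡⟨ %-distribˡ-+ a b m ⟩
  (a % m + b % m) % m    ≡⟨ cong₂ (λ x y → (x + y) % m) a≡c b≡d ⟩
  (c % m + d % m) % m    ≡⟨ %-distribˡ-+ c d m ⟨
  (c + d) % m            ∎
  where open ≡-Reasoning

sumFrom1-cong-% : ∀ m .{{_ : NonZero m}} K {f g : ℕ → ℕ} → (∀ c → f c % m ≡ g c % m) →
                  sumFrom1 K f % m ≡ sumFrom1 K g % m
sumFrom1-cong-% m zero    f≡g = refl
sumFrom1-cong-% m (suc K) {f} {g} f≡g = %-cong-+ m _ _ _ _ (sumFrom1-cong-% m K f≡g) (f≡g (suc K))

2*-cong-%4 : ∀ x y → x % 2 ≡ y % 2 → (2 * x) % 4 ≡ (2 * y) % 4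
2*-cong-%4 x y x≡y = begin
  (2 * x) % 4    ≡⟨ cong (_% 4) (*-comm 2 x) ⟩
  (x * 2) % 4    ≡⟨ m%n*o≡m*o%[n*o] x 2 2 ⟨
  x % 2 * 2      ≡⟨ cong (_* 2) x≡y ⟩
  y % 2 * 2      ≡⟨ m%n*o≡m*o%[n*o] y 2 2 ⟩
  (y * 2) % 4    ≡⟨ cong (_% 4) (*-comm y 2) ⟩
  (2 * y) % 4    ∎
  where open ≡-Reasoning

𝟙 : Bool → ℕ
𝟙 b = if b then 1 else 0

𝟙-true : ∀ b → T b → 𝟙 b ≡ 1
𝟙-true true _ = refl

𝟙-false : ∀ b → ¬ T b → 𝟙 b ≡ 0
𝟙-false false _  = refl
𝟙-false true  ¬t = ⊥-elim (¬t _)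

count : ℕ → (ℕ → Bool) → ℕ
count K P = sumFrom1 K (λ c → 𝟙 (P c))

count-none : ∀ K (P : ℕ → Bool) → (∀ c → 1 ≤ c → c ≤ K → ¬ T (P c)) → count K P ≡ 0
count-none K P none =
  trans (sumFrom1-cong K (λ c 1≤c c≤K → 𝟙-false (P c) (none c 1≤c c≤K))) (sumFrom1-zero K)

count-unique : ∀ K (P : ℕ → Bool) {c} → 1 ≤ c → c ≤ K → T (P c) →
               (∀ c′ → c′ ≤ K → T (P c′) → c′ ≡ c) → count K P ≡ 1
count-unique zero    P 1≤c c≤0 _ _ with () ← ≤-trans 1≤c c≤0
count-unique (suc K) P {c} 1≤c c≤1+K Pc unique with m≤n⇒m<n∨m≡n c≤1+K
... | inj₂ refl =
  cong₂ _+_ (count-none K P (λ c′ _ c′≤K Pc′ → <-irrefl (unique c′ (m≤n⇒m≤1+n c′≤K) Pc′) (s≤s c′≤K)))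
            (𝟙-true (P c) Pc)
... | inj₁ (s≤s c≤K) =
  cong₂ _+_ (count-unique K P 1≤c c≤K Pc (λ c′ c′≤K → unique c′ (m≤n⇒m≤1+n c′≤K)))
            (𝟙-false (P (suc K)) (λ P[1+K] → <-irrefl (sym (unique (suc K) ≤-refl P[1+K])) (s≤s c≤K)))

count-quotients : ∀ s n .{{_ : NonZero s}} .{{_ : NonZero n}} →
                  count n (λ c → c * s ≡ᵇ n) ≡ 𝟙 (does (s ∣? n))
count-quotients s n with s ∣? n
... | no s∤n = count-none n _ (λ c _ _ cs≡n → s∤n (divides c (sym (≡ᵇ⇒≡ _ n cs≡n))))
... | yes (divides c n≡cs) =
  count-unique n _ 1≤c c≤n (≡⇒≡ᵇ _ n (sym n≡cs))
    (λ c′ _ c′s≡n → *-cancelʳ-≡ c′ c s (trans (≡ᵇ⇒≡ _ n c′s≡n) n≡cs))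
  where
  1≤c : 1 ≤ c
  1≤c = n≢0⇒n>0 (λ c≡0 → ≢-nonZero⁻¹ n (trans n≡cs (cong (_* s) c≡0)))
  c≤n : c ≤ n
  c≤n = subst (c ≤_) (sym n≡cs) (m≤m*n c s)

overCount-parity : ∀ ok m n → overCount ok m n % 2 ≡ 𝟙 (n ≡ᵇ 0) % 2
overCount-parity ok zero    n = refl
overCount-parity ok (suc m) n with ok (suc m)
... | false = trans (cong (_% 2) (+-identityʳ (overCount ok m n))) (overCount-parity ok m n)
... | true  = trans (cong (λ t → (overCount ok m n + t) % 2) (*-comm 2 S))
                    (trans ([m+kn]%n≡m%n (overCount ok m n) S 2) (overCount-parity ok m n))
  where S = sumFrom1 n (λ c → if c * suc m ≤ᵇ n then overCount ok m (n ∸ c * suc m) else 0)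

multiplicity-term-parity : ∀ ok m n s c →
  (if c * s ≤ᵇ n then overCount ok m (n ∸ c * s) else 0) % 2 ≡ 𝟙 (c * s ≡ᵇ n) % 2
multiplicity-term-parity ok m n s c with c * s ≤ᵇ n in fits
... | false = cong (_% 2) (sym (𝟙-false (c * s ≡ᵇ n) (subst T fits ∘ ≤⇒≤ᵇ ∘ ≤-reflexive ∘ ≡ᵇ⇒≡ (c * s) n)))
... | true  = trans (overCount-parity ok m (n ∸ c * s))
                    (cong (λ b → 𝟙 b % 2) (rest≡0⇔exact (c * s ≟ n)))
  where
  rest≡0⇔exact : Dec (c * s ≡ n) → (n ∸ c * s ≡ᵇ 0) ≡ (c * s ≡ᵇ n)
  rest≡0⇔exact (yes cs≡n) rewrite cs≡n | n∸n≡0 n | dec-true (n ≟ n) refl = refl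
  rest≡0⇔exact (no cs≢n) =
    trans (dec-false (n ∸ c * s ≟ 0) rest≢0) (sym (dec-false (c * s ≟ n) cs≢n))
    where
    rest≢0 : n ∸ c * s ≢ 0
    rest≢0 rest≡0 = cs≢n (≤-antisym (≤ᵇ⇒≤ (c * s) n (subst T (sym fits) _)) (m∸n≡0⇒m≤n rest≡0))

overCount-mod-4 : ∀ ok m n .{{_ : NonZero n}} →
                  overCount ok m n % 4 ≡ (2 * count m (λ s → ok s ∧ does (s ∣? n))) % 4
overCount-mod-4 ok zero    (suc n) = refl
overCount-mod-4 ok (suc m) n = begin
  (overCount ok m n + new) % 4      ≡⟨ %-cong-+ 4 (overCount ok m n) new (2 * D) _
                                          (overCount-mod-4 ok m n) (new-mod-4 (ok s)) ⟩
  (2 * D + 2 * 𝟙 (ok s ∧ s∣n)) % 4  ≡⟨ cong (_% 4) (*-distribˡ-+ 2 D _) ⟨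
  (2 * (D + 𝟙 (ok s ∧ s∣n))) % 4    ∎
  where
  open ≡-Reasoning
  s = suc m
  s∣n = does (s ∣? n)
  D = count m (λ s → ok s ∧ does (s ∣? n))
  S = sumFrom1 n (λ c → if c * s ≤ᵇ n then overCount ok m (n ∸ c * s) else 0)
  new = if ok s then 2 * S else 0
  S-parity : S % 2 ≡ 𝟙 s∣n % 2
  S-parity = trans (sumFrom1-cong-% 2 n (multiplicity-term-parity ok m n s))
                   (cong (_% 2) (count-quotients s n))
  new-mod-4 : ∀ b → (if b then 2 * S else 0) % 4 ≡ (2 * 𝟙 (b ∧ s∣n)) % 4
  new-mod-4 false = refl
  new-mod-4 true  = 2*-cong-%4 S (𝟙 s∣n) S-parity

countDivisors : (ℕ → Bool) → ℕ → ℕ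
countDivisors ok n = count n (λ s → ok s ∧ does (s ∣? n))

2∣countDivisors⇒4∣Bbar : ∀ ℓ₁ ℓ₂ .{{_ : NonZero ℓ₁}} .{{_ : NonZero ℓ₂}} N .{{_ : NonZero N}} →
                         2 ∣ countDivisors (allowed ℓ₁ ℓ₂) N → 4 ∣ Bbar ℓ₁ ℓ₂ N
2∣countDivisors⇒4∣Bbar ℓ₁ ℓ₂ N (divides c D≡c*2) = m%n≡0⇒n∣m _ 4 (begin
  Bbar ℓ₁ ℓ₂ N % 4                          ≡⟨ overCount-mod-4 (allowed ℓ₁ ℓ₂) N N ⟩
  (2 * countDivisors (allowed ℓ₁ ℓ₂) N) % 4 ≡⟨ cong (λ x → (2 * x) % 4) D≡c*2 ⟩
  (2 * (c * 2)) % 4                         ≡⟨ cong (_% 4) (trans (*-comm 2 (c * 2)) (*-assoc c 2 2)) ⟩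
  (c * 4) % 4                               ≡⟨ m*n%n≡0 c 4 ⟩
  0                                         ∎)
  where open ≡-Reasoning

prime-≢⇒∤ : ∀ {p q} → Prime p → Prime q → p ≢ q → ¬ p ∣ q
prime-≢⇒∤ pp pq p≢q p∣q with prime⇒irreducible pq p∣q
... | inj₁ p≡1 = ¬prime[1] (subst Prime p≡1 pp)
... | inj₂ p≡q = p≢q p≡q

prime-∤m∧∣m*n⇒∣n : ∀ {p m n} → Prime p → ¬ p ∣ m → p ∣ m * n → p ∣ n
prime-∤m∧∣m*n⇒∣n {m = m} {n} pp p∤m p∣mn with euclidsLemma m n pp p∣mn
... | inj₁ p∣m = ⊥-elim (p∤m p∣m)
... | inj₂ p∣n = p∣n

prime-∤m∧∤n⇒∤m*n : ∀ {p m n} → Prime p → ¬ p ∣ m → ¬ p ∣ n → ¬ p ∣ m * n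
prime-∤m∧∤n⇒∤m*n pp p∤m p∤n = p∤n ∘ prime-∤m∧∣m*n⇒∣n pp p∤m

prime-∤⇒coprime : ∀ {p n} → Prime p → ¬ p ∣ n → Coprime n p
prime-∤⇒coprime pp p∤n (d∣n , d∣p) with prime⇒irreducible pp d∣p
... | inj₁ d≡1 = d≡1
... | inj₂ refl = ⊥-elim (p∤n d∣n)

prime-∣square⇒∣ : ∀ {p d} → Prime p → p ∣ d * d → p ∣ d
prime-∣square⇒∣ {d = d} pp = reduce ∘ euclidsLemma d d pp

prime-∤prodSq : ∀ {r k} (ps : Vec ℕ k) → Prime r → All (λ p → ¬ r ∣ p) ps → ¬ r ∣ prodSq ps
prime-∤prodSq []       pr All.[]           r∣1 = ¬prime[1] (subst Prime (∣1⇒≡1 r∣1) pr)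
prime-∤prodSq (p ∷ ps) pr (r∤p All.∷ r∤ps) =
  prime-∤m∧∤n⇒∤m*n pr (prime-∤m∧∤n⇒∤m*n pr r∤p r∤p) (prime-∤prodSq ps pr r∤ps)

∤⇒nonZero : ∀ {d n} → ¬ d ∣ n → NonZero n
∤⇒nonZero {d} d∤n = ≢-nonZero (λ n≡0 → d∤n (subst (d ∣_) (sym n≡0) (d ∣0)))

data OddValuation (q : ℕ) : ℕ → Set where
  v≡1 : ∀ {R} → ¬ q ∣ R → OddValuation q (q * R)
  v+2 : ∀ {X} → OddValuation q X → OddValuation q (q * q * X)

oddValuation⇒nonSquare : ∀ {q X} → Prime q → OddValuation q X → ∀ d → d * d ≢ X
oddValuation⇒nonSquare {q} pq (v≡1 {R} q∤R) d dd≡qR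
  with divides k refl ← prime-∣square⇒∣ {d = d} pq (subst (q ∣_) (sym dd≡qR) (m∣m*n R)) =
  q∤R (divides (k * k) (*-cancelˡ-≡ R (k * k * q) q {{prime⇒nonZero pq}} (trans (sym dd≡qR) (square k q))))
  where
  square : ∀ k q → k * q * (k * q) ≡ q * (k * k * q)
  square = solve-∀
oddValuation⇒nonSquare {q} pq (v+2 {X} ov) d dd≡qqX
  with divides k refl ← prime-∣square⇒∣ {d = d} pq (subst (q ∣_) (sym dd≡qqX) (∣m⇒∣m*n X (m∣m*n q))) =
  oddValuation⇒nonSquare pq ov k
    (*-cancelˡ-≡ (k * k) X (q * q) {{m*n≢0 q q {{nz}} {{nz}}}} (trans (sym (square k q)) dd≡qqX))
  where
  nz = prime⇒nonZero pq
  square : ∀ k q → k * q * (k * q) ≡ q * q * (k * k)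
  square = solve-∀

oddValuation-*ˡ : ∀ {q m X} → Prime q → ¬ q ∣ m → OddValuation q X → OddValuation q (m * X)
oddValuation-*ˡ {q} {m} pq q∤m (v≡1 {R} q∤R) =
  subst (OddValuation q) (m*[n*o]≡n*[m*o] q m R) (v≡1 (prime-∤m∧∤n⇒∤m*n pq q∤m q∤R))
oddValuation-*ˡ {q} {m} pq q∤m (v+2 {X} ov) =
  subst (OddValuation q) (m*[n*o]≡n*[m*o] (q * q) m X) (v+2 (oddValuation-*ˡ pq q∤m ov))

oddValuation-prodSq : ∀ {q k X} (ps : Vec ℕ k) → Prime q → All Prime ps →
                      OddValuation q X → OddValuation q (prodSq ps * X)
oddValuation-prodSq {q} {X = X} [] pq All.[] ov = subst (OddValuation q) (sym (*-identityˡ X)) ov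
oddValuation-prodSq {q} {X = X} (p ∷ ps) pq (pp All.∷ pps) ov =
  subst (OddValuation q) (sym (*-assoc (p * p) (prodSq ps) X)) (times-p² (p ≟ q))
  where
  ov′ = oddValuation-prodSq ps pq pps ov
  times-p² : Dec (p ≡ q) → OddValuation q (p * p * (prodSq ps * X))
  times-p² (yes refl) = v+2 ov′
  times-p² (no p≢q)   = oddValuation-*ˡ pq (prime-∤m∧∤n⇒∤m*n pq q∤p q∤p) ov′
    where q∤p = prime-≢⇒∤ pq pp (p≢q ∘ sym)

oddValuation-cancelʳ : ∀ {q r X Y} → Prime q → Prime r → ¬ r ∣ q →
                       OddValuation q X → X ≡ Y * r → OddValuation q Y
oddValuation-cancelʳ {q} {r} {Y = Y} pq pr r∤q (v≡1 {R} q∤R) qR≡Yr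
  with divides R′ refl ← prime-∤m∧∣m*n⇒∣n pr r∤q (divides Y qR≡Yr) =
  subst (OddValuation q) (*-cancelʳ-≡ (q * R′) Y r {{prime⇒nonZero pr}} (trans (*-assoc q R′ r) qR≡Yr))
    (v≡1 (q∤R ∘ ∣m⇒∣m*n r))
oddValuation-cancelʳ {q} {r} {Y = Y} pq pr r∤q (v+2 {X} ov) qqX≡Yr
  with divides X′ refl ← prime-∤m∧∣m*n⇒∣n pr (prime-∤m∧∤n⇒∤m*n pr r∤q r∤q) (divides Y qqX≡Yr) =
  subst (OddValuation q)
    (*-cancelʳ-≡ (q * q * X′) Y r {{prime⇒nonZero pr}} (trans (*-assoc (q * q) X′ r) qqX≡Yr))
    (v+2 (oddValuation-cancelʳ pq pr r∤q ov refl))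

divisorCount : ℕ → ℕ
divisorCount = countDivisors (λ _ → true)

-- The pairs (d , e) with d * e ≡ X split into those with d < e and those with e < d; there is
-- no diagonal pair because X is not a square.
nonSquare⇒2∣divisorCount : ∀ X .{{_ : NonZero X}} → (∀ d → d * d ≢ X) → 2 ∣ divisorCount X
nonSquare⇒2∣divisorCount X nonSquare = divides A (begin
  divisorCount X                         ≡⟨ sumFrom1-cong X (λ d 1≤d _ → sym (quotients d 1≤d)) ⟩
  ∑ (λ d → ∑ (F d))                      ≡⟨ sumFrom1-cong X (λ d _ _ → sumFrom1-cong X (λ e _ _ → F-split d e)) ⟩
  ∑ (λ d → ∑ (λ e → lt d e + lt e d))    ≡⟨ sumFrom1-cong X (λ d _ _ → sumFrom1-+ X (lt d) (flip lt d)) ⟩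
  ∑ (λ d → ∑ (lt d) + ∑ (flip lt d))     ≡⟨ sumFrom1-+ X (∑ ∘ lt) (∑ ∘ flip lt) ⟩
  A + ∑ (λ d → ∑ (flip lt d))            ≡⟨ cong (λ x → A + x) (sumFrom1-swap X X (flip lt)) ⟩
  A + A                                  ≡⟨ cong (λ x → A + x) (+-identityʳ A) ⟨
  2 * A                                  ≡⟨ *-comm 2 A ⟩
  A * 2                                  ∎)
  where
  open ≡-Reasoning
  ∑ : (ℕ → ℕ) → ℕ
  ∑ = sumFrom1 X
  F : ℕ → ℕ → ℕ
  F d e = 𝟙 (e * d ≡ᵇ X)
  lt : ℕ → ℕ → ℕ
  lt d e = if does (d <? e) then F d e else 0
  A : ℕ
  A = ∑ (λ d → ∑ (lt d))
  quotients : ∀ d → 1 ≤ d → count X (λ e → e * d ≡ᵇ X) ≡ 𝟙 (does (d ∣? X))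
  quotients (suc d) _ = count-quotients (suc d) X
  F-split : ∀ d e → F d e ≡ lt d e + lt e d
  F-split d e with <-cmp d e
  ... | tri< d<e _ e≮d rewrite dec-true (d <? e) d<e | dec-false (e <? d) e≮d =
    sym (+-identityʳ (F d e))
  ... | tri≈ d≮e refl _ rewrite dec-false (d <? d) d≮e =
    𝟙-false (d * d ≡ᵇ X) (nonSquare d ∘ ≡ᵇ⇒≡ (d * d) X)
  ... | tri> d≮e _ e<d rewrite dec-true (e <? d) e<d | dec-false (d <? e) d≮e =
    cong (λ x → 𝟙 (x ≡ᵇ X)) (*-comm e d)

allowed⇒∤ˡ : ∀ ℓ₁ ℓ₂ .{{_ : NonZero ℓ₁}} .{{_ : NonZero ℓ₂}} s → T (allowed ℓ₁ ℓ₂ s) → ¬ ℓ₁ ∣ s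
allowed⇒∤ˡ ℓ₁ ℓ₂ s ok ℓ₁∣s =
  ≢-nonZero⁻¹ (s % ℓ₁) {{record { nonZero = proj₁ (Equivalence.to T-∧ ok) }}} (n∣m⇒m%n≡0 s ℓ₁ ℓ₁∣s)

∤⇒allowed : ∀ ℓ₁ ℓ₂ .{{_ : NonZero ℓ₁}} .{{_ : NonZero ℓ₂}} s → ¬ ℓ₁ ∣ s → ¬ ℓ₂ ∣ s → T (allowed ℓ₁ ℓ₂ s)
∤⇒allowed ℓ₁ ℓ₂ s ℓ₁∤s ℓ₂∤s = Equivalence.from T-∧ (remainder≢0 ℓ₁∤s , remainder≢0 ℓ₂∤s)
  where
  remainder≢0 : ∀ {ℓ} .{{_ : NonZero ℓ}} → ¬ ℓ ∣ s → T (not (s % ℓ ≡ᵇ 0))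
  remainder≢0 {ℓ} ℓ∤s = NonZero.nonZero (≢-nonZero (ℓ∤s ∘ m%n≡0⇒n∣m s ℓ))

countDivisors-cancelʳ : ∀ ok {r} → Prime r → (∀ s → T (ok s) → ¬ r ∣ s) → ∀ X .{{_ : NonZero X}} →
                        countDivisors ok (X * r) ≡ countDivisors ok X
countDivisors-cancelʳ ok {r} pr ok⇒r∤ X = begin
  count (X * r) (λ s → ok s ∧ does (s ∣? X * r)) ≡⟨ sumFrom1-cong (X * r) (λ s _ _ → cong 𝟙 (same s)) ⟩
  count (X * r) (λ s → ok s ∧ does (s ∣? X))     ≡⟨ sumFrom1-truncate (X * r) _ (m≤m*n X r) beyond ⟩
  countDivisors ok X                             ∎
  where
  open ≡-Reasoning
  instance _ = prime⇒nonZero pr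
  same : ∀ s → ok s ∧ does (s ∣? X * r) ≡ ok s ∧ does (s ∣? X)
  same s with ok s in okˢ
  ... | false = refl
  ... | true  = does-⇔ (mk⇔ (coprime-divisor s⊥r ∘ subst (s ∣_) (*-comm X r)) (∣m⇒∣m*n r))
                       (s ∣? X * r) (s ∣? X)
    where s⊥r = prime-∤⇒coprime pr (ok⇒r∤ s (subst T (sym okˢ) _))
  beyond : ∀ s → X < s → 𝟙 (ok s ∧ does (s ∣? X)) ≡ 0
  beyond s X<s with s ∣? X
  ... | yes s∣X = ⊥-elim (<⇒≱ X<s (∣⇒≤ s∣X))
  ... | no  _   = cong 𝟙 (∧-zeroʳ (ok s))

countDivisors-all : ∀ ok X → (∀ d → d ∣ X → T (ok d)) → countDivisors ok X ≡ divisorCount X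
countDivisors-all ok X all = sumFrom1-cong X (λ d _ _ → cong 𝟙 (same d))
  where
  same : ∀ d → ok d ∧ does (d ∣? X) ≡ does (d ∣? X)
  same d with d ∣? X
  ... | yes d∣X = trans (∧-identityʳ (ok d)) (Equivalence.to T-≡ (all d d∣X))
  ... | no  _   = ∧-zeroʳ (ok d)

-- Dividing out the factors 5 leaves both the count and the odd q-valuation unchanged.
oddValuation⇒2∣countDivisors-5-2 : ∀ {q} → Prime q → q ≢ 5 → ∀ X → OddValuation q X → ¬ 2 ∣ X →
                                   2 ∣ countDivisors (allowed 5 2) X
oddValuation⇒2∣countDivisors-5-2 {q} pq q≢5 X = go X (<-wellFounded X)
  where
  prime[5] : Prime 5
  prime[5] = from-yes (prime? 5)
  go : ∀ X → Acc _<_ X → OddValuation q X → ¬ 2 ∣ X → 2 ∣ countDivisors (allowed 5 2) X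
  go X (acc smaller) ov 2∤X with 5 ∣? X
  ... | yes (divides Y refl) =
    subst (2 ∣_) (sym (countDivisors-cancelʳ (allowed 5 2) prime[5] (allowed⇒∤ˡ 5 2) Y))
      (go Y (smaller (m<m*n Y 5 (s≤s (s≤s z≤n))))
          (oddValuation-cancelʳ pq prime[5] (prime-≢⇒∤ prime[5] pq (q≢5 ∘ sym)) ov refl) 2∤Y)
    where
    2∤Y = 2∤X ∘ ∣m⇒∣m*n 5
    instance _ = ∤⇒nonZero 2∤Y
  ... | no 5∤X =
    subst (2 ∣_) (sym (countDivisors-all (allowed 5 2) X
                         (λ d d∣X → ∤⇒allowed 5 2 d (5∤X ∘ flip ∣-trans d∣X) (2∤X ∘ flip ∣-trans d∣X))))
      (nonSquare⇒2∣divisorCount X (oddValuation⇒nonSquare pq ov))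
    where instance _ = ∤⇒nonZero 2∤X

oddValuation⇒4∣Bbar-5-2 : ∀ {q N} → Prime q → q ≢ 5 → OddValuation q N → ¬ 2 ∣ N → 4 ∣ Bbar 5 2 N
oddValuation⇒4∣Bbar-5-2 {N = N} pq q≢5 ov 2∤N =
  2∣countDivisors⇒4∣Bbar 5 2 N {{∤⇒nonZero 2∤N}} (oddValuation⇒2∣countDivisors-5-2 pq q≢5 N ov 2∤N)

cofactor : ℕ → ℕ → ℤ → ℤ
cofactor q n j = + (4 * q * n) ℤ.+ (+ 4 ℤ.* j ℤ.+ + q)

N≡P*q*∣cofactor∣ : ∀ P q n j N → + N ≡ + (4 * P * (q * q) * n) ℤ.+ (+ 4 ℤ.* j ℤ.+ + q) ℤ.* + (P * q) →
                   N ≡ P * q * ℤ.∣ cofactor q n j ∣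
N≡P*q*∣cofactor∣ P q n j N N≡ = begin
  N                                                       ≡⟨ cong ℤ.∣_∣ N≡ ⟩
  ℤ.∣ + (4 * P * (q * q) * n) ℤ.+ 4j+q ℤ.* + (P * q) ∣    ≡⟨ cong ℤ.∣_∣ factor ⟩
  ℤ.∣ + (P * q) ℤ.* cofactor q n j ∣                      ≡⟨ ℤ.abs-* (+ (P * q)) (cofactor q n j) ⟩
  P * q * ℤ.∣ cofactor q n j ∣                            ∎
  where
  open ≡-Reasoning
  4j+q = + 4 ℤ.* j ℤ.+ + q
  reorder : ∀ P q n → 4 * P * (q * q) * n ≡ P * q * (4 * q * n)
  reorder = solve-∀
  factor : + (4 * P * (q * q) * n) ℤ.+ 4j+q ℤ.* + (P * q) ≡ + (P * q) ℤ.* cofactor q n j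
  factor = trans (cong₂ ℤ._+_ (trans (cong +_ (reorder P q n)) (ℤ.pos-* (P * q) (4 * q * n)))
                              (ℤ.*-comm 4j+q (+ (P * q))))
                 (sym (ℤ.*-distribˡ-+ (+ (P * q)) (+ (4 * q * n)) 4j+q))

∣cofactor⇒∣4j+q : ∀ {d q} n j → d ∣ 4 * q * n → + d ∣ℤ cofactor q n j →
                  ℤ∣._∣_ (+ d) (+ 4 ℤ.* j ℤ.+ + q)
∣cofactor⇒∣4j+q {q = q} n j d∣4qn d∣cofactor =
  ℤ∣.∣m+n∣m⇒∣n {m = + (4 * q * n)} (ℤ∣.∣ᵤ⇒∣ d∣cofactor) (ℤ∣.∣ᵤ⇒∣ {i = + (4 * q * n)} d∣4qn)

q∤cofactor : ∀ {q} n j → Prime q → q ≢ 2 → ¬ (+ q ∣ℤ j) → ¬ (+ q ∣ℤ cofactor q n j)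
q∤cofactor {q} n j pq q≢2 q∤j q∣cofactor =
  q∤j (q∣2*⇒∣ (q∣2*⇒∣ (subst (q ∣_) ∣4j∣≡2*[2*∣j∣] q∣4j)))
  where
  q∣2*⇒∣ : ∀ {m} → q ∣ 2 * m → q ∣ m
  q∣2*⇒∣ = prime-∤m∧∣m*n⇒∣n pq (prime-≢⇒∤ pq prime[2] q≢2)
  q∣4j : q ∣ ℤ.∣ + 4 ℤ.* j ∣
  q∣4j = ℤ∣.∣⇒∣ᵤ (ℤ∣.∣m+n∣n⇒∣m {m = + 4 ℤ.* j}
           (∣cofactor⇒∣4j+q n j (∣m⇒∣m*n n (n∣m*n 4)) q∣cofactor) ℤ∣.∣-refl)
  ∣4j∣≡2*[2*∣j∣] : ℤ.∣ + 4 ℤ.* j ∣ ≡ 2 * (2 * ℤ.∣ j ∣)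
  ∣4j∣≡2*[2*∣j∣] = trans (ℤ.abs-* (+ 4) j) (*-assoc 2 2 ℤ.∣ j ∣)

2∤cofactor : ∀ {q} n j → ¬ 2 ∣ q → ¬ (+ 2 ∣ℤ cofactor q n j)
2∤cofactor {q} n j 2∤q 2∣cofactor =
  2∤q (ℤ∣.∣⇒∣ᵤ (ℤ∣.∣m+n∣m⇒∣n {m = + 4 ℤ.* j}
                  (∣cofactor⇒∣4j+q n j (∣m⇒∣m*n n (∣m⇒∣m*n q 2∣4)) 2∣cofactor)
                  (ℤ∣.∣m⇒∣m*n j (ℤ∣.∣ᵤ⇒∣ {i = + 4} 2∣4))))
  where
  2∣4 : 2 ∣ 4
  2∣4 = divides 2 refl

theorem5p2 : (k n : ℕ) (ps : Vec ℕ k) (q : ℕ) →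
    All (λ p → Prime p × p ≢ 2 × p % 4 ≢ 1) ps →
    Prime q → q ≢ 2 → q % 4 ≢ 1 →
    (j : ℤ) → ¬ ((+ q) ∣ℤ j) →
    (N : ℕ) →
    + N ≡ Data.Integer._+_ (+ (4 Data.Nat.* prodSq ps Data.Nat.* (q Data.Nat.* q) Data.Nat.* n))
            (Data.Integer._*_ (Data.Integer._+_ (Data.Integer._*_ (+ 4) j) (+ q)) (+ (prodSq ps Data.Nat.* q))) →
    4 ∣ Bbar 5 2 N
theorem5p2 k n ps q ps-ok pq q≢2 q%4≢1 j q∤j N N≡ =
  oddValuation⇒4∣Bbar-5-2 pq (q%4≢1 ∘ cong (_% 4)) (subst (OddValuation q) (sym N≡P*[q*R]) ov) 2∤N
  where
  P = prodSq ps
  R = ℤ.∣ cofactor q n j ∣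
  N≡P*[q*R] : N ≡ P * (q * R)
  N≡P*[q*R] = trans (N≡P*q*∣cofactor∣ P q n j N N≡) (*-assoc P q R)
  -- ¬ (+ q ∣ℤ z) unfolds to ¬ q ∣ ℤ.∣ z ∣, so the facts about the cofactor apply to R directly.
  ov : OddValuation q (P * (q * R))
  ov = oddValuation-prodSq ps pq (All.map proj₁ ps-ok) (v≡1 (q∤cofactor n j pq q≢2 q∤j))
  2∤q = prime-≢⇒∤ prime[2] pq (q≢2 ∘ sym)
  2∤P = prime-∤prodSq ps prime[2]
          (All.map (λ (pp , p≢2 , _) → prime-≢⇒∤ prime[2] pp (p≢2 ∘ sym)) ps-ok)
  2∤N : ¬ 2 ∣ N
  2∤N = subst (¬_ ∘ (2 ∣_)) (sym N≡P*[q*R])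
          (prime-∤m∧∤n⇒∤m*n prime[2] 2∤P (prime-∤m∧∤n⇒∤m*n prime[2] 2∤q (2∤cofactor n j 2∤q)))
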